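{- Let $n$ be a positive integer. Then $\sigma^{**}(n)$ is odd if and only if $n$ is a power of $2$ (including $n=1$). More precisely, $\sigma^{**}(n)$ is divisible by $2^{\omega(n)}$ if $n$ is odd, and by $2^{\omega(n)-1}$ if $n$ is even.
   Context: $\omega(n)$ is the number of distinct prime factors of $n$. $\sigma^{**}(n)$ is the sum of the biunitary divisors of $n$, where a divisor $d$ of $n$ is biunitary if the greatest common unitary divisor of $d$ and $n/d$ is $1$ (a divisor $u$ of $m$ is unitary if $\gcd(u,m/u)=1$). Equivalently, $\sigma^{**}$ is multiplicative and for a prime $p$ and positive integer $e$: $\sigma^{**}(p^e)=\frac{p^{e+1}-1}{p-1}$ if $e$ is odd, and $\sigma^{**}(p^e)=\frac{p^{e+1}-1}{p-1}-p^{e/2}$ if $e$ is even. -}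

module Defs where

open import Data.Nat using (ℕ; zero; suc; _+_; _≡ᵇ_; _⊔_; _/_)
open import Data.Nat.Divisibility using (_∣?_)
open import Data.Nat.GCD using (gcd)
open import Data.Nat.Primality using (prime?)
open import Data.Bool using (Bool; true; false; _∧_)
open import Data.List using (List; map; upTo; filter; filterᵇ; length; foldr)
open import Data.Nat.ListAction using (sum)
open import Relation.Nullary.Decidable using (⌊_⌋)

range1 : ℕ → List ℕ
range1 n = map suc (upTo n)

isUnitaryDivᵇ : ℕ → ℕ → Bool
isUnitaryDivᵇ zero    m = false
isUnitaryDivᵇ (suc k) m = ⌊ suc k ∣? m ⌋ ∧ (gcd (suc k) (m / suc k) ≡ᵇ 1)

-- common unitary divisors of a and b (all lie in [1 .. a + b] when a,b ≥ 1)
commonUnitaryDivs : ℕ → ℕ → List ℕ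
commonUnitaryDivs a b = filterᵇ (λ u → isUnitaryDivᵇ u a ∧ isUnitaryDivᵇ u b) (range1 (a + b))

gcud : ℕ → ℕ → ℕ
gcud a b = foldr _⊔_ 0 (commonUnitaryDivs a b)

isBiunitaryDivᵇ : ℕ → ℕ → Bool
isBiunitaryDivᵇ zero    n = false
isBiunitaryDivᵇ (suc k) n = ⌊ suc k ∣? n ⌋ ∧ (gcud (suc k) (n / suc k) ≡ᵇ 1)

σ** : ℕ → ℕ
σ** n = sum (filterᵇ (λ d → isBiunitaryDivᵇ d n) (range1 n))

ω : ℕ → ℕ
ω n = length (filter prime? (filterᵇ (λ d → ⌊ d ∣? n ⌋) (range1 n)))

-- Proof. σ** is multiplicative: for coprime a, b, the map (d₁, d₂) ↦ d₁d₂ is a bijection from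
-- pairs of biunitary divisors of a and b onto the biunitary divisors of ab. This rests on a
-- cross factorisation of de = ab and on the compatibility of unitary coprimality
-- (gcud = 1) with such factorisations. For an odd q > 1, σ**(q) is even, because
-- d ↦ q/d is a fixed-point-free involution of the biunitary divisors of q pairing odd
-- numbers; and σ**(2^e) is odd, because every biunitary divisor of 2^e except 1 is even.
-- Splitting off prime powers, strong induction gives 2^ω(m) ∣ σ**(m) for odd m, and the
-- theorem follows by writing n = 2^k r with r odd.
module Submission where

open import Defs
open import Data.Nat using (ℕ; zero; suc; _+_; _*_; _<_; _≤_; _^_; _∸_; _⊔_; _/_; z≤n; s≤s; >-nonZero; >-nonZero⁻¹; nonTrivial⇒n>1)
open import Data.Nat.Properties
open import Data.Nat.Divisibility
open import Data.Nat.DivMod using (_%_; m%n<n; %-distribˡ-+; m*n/n≡m; m*[n/m]≡n)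
open import Data.Nat.GCD using (gcd; gcd[m,n]∣m; gcd[m,n]∣n; gcd-greatest)
open import Data.Nat.Coprimality as Coprime using (Coprime; coprime-divisor; gcd≡1⇒coprime; coprime⇒gcd≡1; 1-coprimeTo)
open import Data.Nat.Primality using (Prime; prime?; prime[2]; ¬prime[1]; euclidsLemma; prime⇒irreducible; prime⇒nonZero; prime⇒nonTrivial)
open import Data.Nat.Primality.Factorisation using (factorise; PrimeFactorisation)
open import Data.Nat.Induction using (<-rec)
open import Data.Nat.ListAction using (sum; product)
open import Data.Nat.ListAction.Properties using (sum-↭; sum-++)
open import Data.Nat.Tactic.RingSolver using (solve-∀)
open import Data.Bool using (T; T?; _∧_)
open import Data.Bool.Properties using (T-∧)
open import Data.List using (List; []; _∷_; map; filter; filterᵇ; _++_; foldr; length; cartesianProduct)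
open import Data.List.Properties using (map-++; map-∘)
open import Data.List.Membership.Propositional using (_∈_)
open import Data.List.Membership.Propositional.Properties
  using (∈-map⁻; ∈-map⁺; ∈-filter⁻; ∈-filter⁺; ∈-upTo⁺; ∈-upTo⁻; ∈-cartesianProduct⁻; ∈-cartesianProduct⁺)
open import Data.List.Membership.Propositional.Properties.WithK using (unique∧set⇒bag)
open import Data.List.Relation.Unary.All as All using (All; []; _∷_)
open import Data.List.Relation.Unary.AllPairs using ([]; _∷_)
open import Data.List.Relation.Unary.Any using (here; there)
open import Data.List.Relation.Unary.Unique.Propositional using (Unique)
import Data.List.Relation.Unary.Unique.Propositional.Properties as Unique
open import Data.List.Relation.Binary.BagAndSetEquality using (∼bag⇒↭)
open import Data.List.Relation.Binary.Permutation.Propositional using (_↭_)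
open import Data.List.Relation.Binary.Permutation.Propositional.Properties using (↭-length)
open import Data.Product using (_×_; _,_; ∃; proj₁; proj₂; uncurry)
open import Data.Sum using (inj₁; inj₂)
open import Data.Empty using (⊥; ⊥-elim)
open import Relation.Binary.PropositionalEquality
open import Relation.Nullary using (¬_; yes; no; ¬?)
open import Relation.Nullary.Decidable using (⌊_⌋; toWitness; fromWitness)
open import Relation.Unary using (Pred; Decidable)
open import Level using (0ℓ)
open import Function.Bundles using (_⇔_; mk⇔; Equivalence)
open Equivalence using (to; from)

sameMembers⇒↭ : ∀ {A : Set} {xs ys : List A} → Unique xs → Unique ys →
  (∀ {x} → x ∈ xs ⇔ x ∈ ys) → xs ↭ ys
sameMembers⇒↭ uxs uys same = ∼bag⇒↭ (unique∧set⇒bag uxs uys same)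

sameMembers⇒sum≡ : ∀ {xs ys : List ℕ} → Unique xs → Unique ys →
  (∀ {x} → x ∈ xs ⇔ x ∈ ys) → sum xs ≡ sum ys
sameMembers⇒sum≡ uxs uys same = sum-↭ (sameMembers⇒↭ uxs uys same)

sameMembers⇒length≡ : ∀ {A : Set} {xs ys : List A} → Unique xs → Unique ys →
  (∀ {x} → x ∈ xs ⇔ x ∈ ys) → length xs ≡ length ys
sameMembers⇒length≡ uxs uys same = ↭-length (sameMembers⇒↭ uxs uys same)

map-unique : ∀ {A B : Set} (f : A → B) {xs : List A} → Unique xs →
  (∀ {x y} → x ∈ xs → y ∈ xs → f x ≡ f y → x ≡ y) → Unique (map f xs)
map-unique f {[]} [] inj = []
map-unique f {x ∷ xs} (x∉xs ∷ uxs) inj =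
  All.tabulate (λ fy∈ fx≡fy → let (y , y∈ , fy≡) = ∈-map⁻ f fy∈ in
    All.lookup x∉xs y∈ (inj (here refl) (there y∈) (trans fx≡fy fy≡)))
  ∷ map-unique f uxs (λ x∈ y∈ → inj (there x∈) (there y∈))

sum-partition : ∀ {P : Pred ℕ 0ℓ} (P? : Decidable P) (xs : List ℕ) →
  sum xs ≡ sum (filter P? xs) + sum (filter (λ x → ¬? (P? x)) xs)
sum-partition P? [] = refl
sum-partition P? (x ∷ xs) with P? x
... | yes _ = trans (cong (x +_) (sum-partition P? xs)) (sym (+-assoc x _ _))
... | no _ = trans (cong (x +_) (sum-partition P? xs)) (+-exchange x (sum (filter P? xs)) _)
  where
  +-exchange : ∀ a b c → a + (b + c) ≡ b + (a + c)
  +-exchange = solve-∀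

sum-map-* : ∀ x (ys : List ℕ) → sum (map (x *_) ys) ≡ x * sum ys
sum-map-* x [] = sym (*-zeroʳ x)
sum-map-* x (y ∷ ys) = trans (cong (x * y +_) (sum-map-* x ys)) (sym (*-distribˡ-+ x y _))

sum-cartesianProduct : ∀ (xs ys : List ℕ) →
  sum (map (uncurry _*_) (cartesianProduct xs ys)) ≡ sum xs * sum ys
sum-cartesianProduct [] ys = refl
sum-cartesianProduct (x ∷ xs) ys = begin
  sum (map (uncurry _*_) (map (x ,_) ys ++ cartesianProduct xs ys))
    ≡⟨ cong sum (map-++ (uncurry _*_) (map (x ,_) ys) _) ⟩
  sum (map (uncurry _*_) (map (x ,_) ys) ++ map (uncurry _*_) (cartesianProduct xs ys))
    ≡⟨ sum-++ (map (uncurry _*_) (map (x ,_) ys)) _ ⟩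
  sum (map (uncurry _*_) (map (x ,_) ys)) + sum (map (uncurry _*_) (cartesianProduct xs ys))
    ≡⟨ cong₂ _+_ (cong sum (sym (map-∘ ys))) (sum-cartesianProduct xs ys) ⟩
  sum (map (x *_) ys) + sum xs * sum ys
    ≡⟨ cong (_+ sum xs * sum ys) (sum-map-* x ys) ⟩
  x * sum ys + sum xs * sum ys
    ≡⟨ sym (*-distribʳ-+ (sum ys) x (sum xs)) ⟩
  (x + sum xs) * sum ys ∎
  where open ≡-Reasoning

sum-even : ∀ (xs : List ℕ) → (∀ {x} → x ∈ xs → 2 ∣ x) → 2 ∣ sum xs
sum-even [] _ = divides 0 refl
sum-even (x ∷ xs) even = ∣m∣n⇒∣m+n (even (here refl)) (sum-even xs (λ x∈ → even (there x∈)))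

sum-pairs-even : ∀ (f : ℕ → ℕ) (A : List ℕ) → (∀ {x} → x ∈ A → 2 ∣ x + f x) →
  2 ∣ sum A + sum (map f A)
sum-pairs-even f [] _ = divides 0 refl
sum-pairs-even f (x ∷ A) even = subst (2 ∣_) (regroup x (sum A) (f x) (sum (map f A)))
  (∣m∣n⇒∣m+n (even (here refl)) (sum-pairs-even f A (λ x∈ → even (there x∈))))
  where
  regroup : ∀ a b c d → (a + c) + (b + d) ≡ (a + b) + (c + d)
  regroup = solve-∀

-- If a fixed-point-free involution f of a duplicate-free list L satisfies 2 ∣ x + f x,
-- then the sum of L is even: L splits into A = {x | x < f x} and f(A).
involution-sum-even : ∀ (L : List ℕ) → Unique L → (f : ℕ → ℕ) →
  (∀ {x} → x ∈ L → f x ∈ L) → (∀ {x} → x ∈ L → f (f x) ≡ x) → (∀ {x} → x ∈ L → f x ≢ x) →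
  (∀ {x} → x ∈ L → 2 ∣ x + f x) → 2 ∣ sum L
involution-sum-even L uL f closed invol noFix even =
  subst (2 ∣_) (sym sum-L) (sum-pairs-even f A (λ x∈A → even (proj₁ (∈-filter⁻ below? x∈A))))
  where
  below? = λ x → x <? f x
  A = filter below? L
  B = filter (λ x → ¬? (below? x)) L
  f-inj : ∀ {x y} → x ∈ A → y ∈ A → f x ≡ f y → x ≡ y
  f-inj x∈ y∈ fx≡fy = trans (sym (invol (proj₁ (∈-filter⁻ below? x∈))))
    (trans (cong f fx≡fy) (invol (proj₁ (∈-filter⁻ below? y∈))))
  B⊆fA : ∀ {y} → y ∈ B → y ∈ map f A
  B⊆fA {y} y∈B with ∈-filter⁻ (λ x → ¬? (below? x)) {xs = L} y∈B
  ... | (y∈L , y≮fy) = subst (_∈ map f A) (invol y∈L) (∈-map⁺ f (∈-filter⁺ below? (closed y∈L)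
         (subst (f y <_) (sym (invol y∈L)) (≤∧≢⇒< (≮⇒≥ y≮fy) (noFix y∈L)))))
  fA⊆B : ∀ {y} → y ∈ map f A → y ∈ B
  fA⊆B fx∈ with ∈-map⁻ f fx∈
  ... | (x , x∈A , refl) with ∈-filter⁻ below? {xs = L} x∈A
  ... | (x∈L , x<fx) = ∈-filter⁺ (λ x → ¬? (below? x)) (closed x∈L)
         (λ fx<ffx → <-asym x<fx (subst (f x <_) (invol x∈L) fx<ffx))
  sum-L : sum L ≡ sum A + sum (map f A)
  sum-L = trans (sum-partition below? L) (cong (sum A +_)
    (sameMembers⇒sum≡ (Unique.filter⁺ _ uL) (map-unique f (Unique.filter⁺ _ uL) f-inj) (mk⇔ B⊆fA fA⊆B)))

factors-positive : ∀ {x y} → 1 ≤ x * y → 1 ≤ x × 1 ≤ y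
factors-positive {suc x} {suc y} _ = s≤s z≤n , s≤s z≤n
factors-positive {suc x} {zero} h = ⊥-elim (<⇒≢ h (sym (*-zeroʳ x)))

factor-≤ : ∀ {n} d e → 1 ≤ n → n ≡ d * e → d ≤ n
factor-≤ {n} d e n≥1 n≡de = ∣⇒≤ {{>-nonZero n≥1}} (divides e (trans n≡de (*-comm d e)))

UnitaryDivisor : ℕ → ℕ → Set
UnitaryDivisor u x = ∃ λ v → x ≡ u * v × Coprime u v

UnitarilyCoprime : ℕ → ℕ → Set
UnitarilyCoprime a b = ∀ u → 1 < u → UnitaryDivisor u a → UnitaryDivisor u b → ⊥

BiunitaryDivisor : ℕ → ℕ → Set
BiunitaryDivisor d n = ∃ λ e → n ≡ d * e × UnitarilyCoprime d e

unitary-1 : ∀ x → UnitaryDivisor 1 x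
unitary-1 x = x , sym (*-identityˡ x) , 1-coprimeTo x

unitary-self : ∀ x → UnitaryDivisor x x
unitary-self x = 1 , sym (*-identityʳ x) , Coprime.sym (1-coprimeTo x)

unitary-∣ : ∀ {u x} → UnitaryDivisor u x → u ∣ x
unitary-∣ {u} (v , x≡uv , _) = divides v (trans x≡uv (*-comm u v))

unitarilyCoprime-sym : ∀ {a b} → UnitarilyCoprime a b → UnitarilyCoprime b a
unitarilyCoprime-sym cop u u>1 ua ub = cop u u>1 ub ua

∈-range1⁻ : ∀ {x n} → x ∈ range1 n → 1 ≤ x × x ≤ n
∈-range1⁻ x∈ with ∈-map⁻ suc x∈
... | (i , i∈ , refl) = s≤s z≤n , ∈-upTo⁻ i∈

∈-range1⁺ : ∀ {x n} → 1 ≤ x → x ≤ n → x ∈ range1 n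
∈-range1⁺ {suc i} _ x≤n = ∈-map⁺ suc (∈-upTo⁺ x≤n)

range1-unique : ∀ n → Unique (range1 n)
range1-unique n = Unique.map⁺ suc-injective (Unique.upTo⁺ n)

isUnitaryDivᵇ-sound : ∀ k m → T (isUnitaryDivᵇ (suc k) m) → UnitaryDivisor (suc k) m
isUnitaryDivᵇ-sound k m t with to T-∧ t
... | (divides? , gcd≡1) = m / suc k , sym (m*[n/m]≡n (toWitness divides?)) ,
      gcd≡1⇒coprime (≡ᵇ⇒≡ _ 1 gcd≡1)

isUnitaryDivᵇ-complete : ∀ k m → UnitaryDivisor (suc k) m → T (isUnitaryDivᵇ (suc k) m)
isUnitaryDivᵇ-complete k m (v , refl , cop) = from T-∧ (fromWitness (m∣m*n v) ,
  ≡⇒≡ᵇ _ 1 (trans (cong (gcd (suc k)) quotient≡v) (coprime⇒gcd≡1 cop)))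
  where
  quotient≡v : suc k * v / suc k ≡ v
  quotient≡v = trans (cong (_/ suc k) (*-comm (suc k) v)) (m*n/n≡m v (suc k))

maximum-≥ : ∀ {x} (xs : List ℕ) → x ∈ xs → x ≤ foldr _⊔_ 0 xs
maximum-≥ (y ∷ ys) (here refl) = m≤m⊔n y _
maximum-≥ (y ∷ ys) (there x∈) = ≤-trans (maximum-≥ ys x∈) (m≤n⊔m y _)

maximum-≤ : ∀ {b} (xs : List ℕ) → (∀ {x} → x ∈ xs → x ≤ b) → foldr _⊔_ 0 xs ≤ b
maximum-≤ [] _ = z≤n
maximum-≤ (y ∷ ys) bound = ⊔-lub (bound (here refl)) (maximum-≤ ys (λ x∈ → bound (there x∈)))

-- The members of commonUnitaryDivs a b are the common unitary divisors of a and b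
-- (for a ≥ 1 every unitary divisor of a lies in the searched range [1 .. a + b]).
∈-commonUnitaryDivs⁻ : ∀ {a b x} → x ∈ commonUnitaryDivs a b → UnitaryDivisor x a × UnitaryDivisor x b
∈-commonUnitaryDivs⁻ {a} {b} {x} x∈ = unpack x (∈-filter⁻ common? {xs = range1 (a + b)} x∈)
  where
  common? = λ u → T? (isUnitaryDivᵇ u a ∧ isUnitaryDivᵇ u b)
  unpack : ∀ x → x ∈ range1 (a + b) × T (isUnitaryDivᵇ x a ∧ isUnitaryDivᵇ x b) →
    UnitaryDivisor x a × UnitaryDivisor x b
  unpack zero (x∈range , _) with () ← proj₁ (∈-range1⁻ x∈range)
  unpack (suc k) (_ , t) with to (T-∧ {isUnitaryDivᵇ (suc k) a}) t
  ... | (ta , tb) = isUnitaryDivᵇ-sound k a ta , isUnitaryDivᵇ-sound k b tb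

∈-commonUnitaryDivs⁺ : ∀ {a b x} → 1 ≤ a → 1 ≤ x →
  UnitaryDivisor x a → UnitaryDivisor x b → x ∈ commonUnitaryDivs a b
∈-commonUnitaryDivs⁺ {a} {b} {suc k} a≥1 x≥1 ua@(v , a≡xv , _) ub =
  ∈-filter⁺ (λ u → T? (isUnitaryDivᵇ u a ∧ isUnitaryDivᵇ u b))
    (∈-range1⁺ x≥1 (≤-trans (factor-≤ (suc k) v a≥1 a≡xv) (m≤m+n a b)))
    (from T-∧ (isUnitaryDivᵇ-complete k a ua , isUnitaryDivᵇ-complete k b ub))

gcud≡1⇒unitarilyCoprime : ∀ {a b} → 1 ≤ a → gcud a b ≡ 1 → UnitarilyCoprime a b
gcud≡1⇒unitarilyCoprime {a} {b} a≥1 gcud≡1 u u>1 ua ub = <⇒≱ u>1 (subst (u ≤_) gcud≡1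
  (maximum-≥ (commonUnitaryDivs a b) (∈-commonUnitaryDivs⁺ a≥1 (<⇒≤ u>1) ua ub)))

unitarilyCoprime⇒gcud≡1 : ∀ {a b} → 1 ≤ a → UnitarilyCoprime a b → gcud a b ≡ 1
unitarilyCoprime⇒gcud≡1 {a} {b} a≥1 cop = ≤-antisym
  (maximum-≤ (commonUnitaryDivs a b) (λ x∈ → let (ua , ub) = ∈-commonUnitaryDivs⁻ {a} {b} x∈ in
     ≮⇒≥ (λ x>1 → cop _ x>1 ua ub)))
  (maximum-≥ (commonUnitaryDivs a b) (∈-commonUnitaryDivs⁺ a≥1 ≤-refl (unitary-1 a) (unitary-1 b)))

isBiunitaryDivᵇ-sound : ∀ k n → T (isBiunitaryDivᵇ (suc k) n) → BiunitaryDivisor (suc k) n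
isBiunitaryDivᵇ-sound k n t with to T-∧ t
... | (divides? , gcud≡1) = n / suc k , sym (m*[n/m]≡n (toWitness divides?)) ,
      gcud≡1⇒unitarilyCoprime (s≤s z≤n) (≡ᵇ⇒≡ _ 1 gcud≡1)

isBiunitaryDivᵇ-complete : ∀ k n → BiunitaryDivisor (suc k) n → T (isBiunitaryDivᵇ (suc k) n)
isBiunitaryDivᵇ-complete k n (e , refl , cop) = from T-∧ (fromWitness (m∣m*n e) ,
  ≡⇒≡ᵇ _ 1 (trans (cong (gcud (suc k)) quotient≡e) (unitarilyCoprime⇒gcud≡1 (s≤s z≤n) cop)))
  where
  quotient≡e : suc k * e / suc k ≡ e
  quotient≡e = trans (cong (_/ suc k) (*-comm (suc k) e)) (m*n/n≡m e (suc k))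

biunitaryDivisors : ℕ → List ℕ
biunitaryDivisors n = filterᵇ (λ d → isBiunitaryDivᵇ d n) (range1 n)

biunitaryDivisors-unique : ∀ n → Unique (biunitaryDivisors n)
biunitaryDivisors-unique n = Unique.filter⁺ _ (range1-unique n)

∈-biunitaryDivisors : ∀ {n d} → 1 ≤ n → d ∈ biunitaryDivisors n ⇔ BiunitaryDivisor d n
∈-biunitaryDivisors {n} {d} n≥1 = mk⇔ (sound d) (complete d)
  where
  bi? = λ d → T? (isBiunitaryDivᵇ d n)
  sound : ∀ d → d ∈ biunitaryDivisors n → BiunitaryDivisor d n
  sound d d∈ with ∈-filter⁻ bi? {xs = range1 n} d∈
  sound zero    d∈ | (d∈range , _) with () ← proj₁ (∈-range1⁻ d∈range)
  sound (suc k) d∈ | (_ , t) = isBiunitaryDivᵇ-sound k n t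
  complete : ∀ d → BiunitaryDivisor d n → d ∈ biunitaryDivisors n
  complete zero (e , n≡0 , _) = ⊥-elim (<⇒≢ n≥1 (sym n≡0))
  complete (suc k) bd@(e , n≡de , _) =
    ∈-filter⁺ bi? (∈-range1⁺ (s≤s z≤n) (factor-≤ (suc k) e n≥1 n≡de)) (isBiunitaryDivᵇ-complete k n bd)

primeDivisors : ℕ → List ℕ
primeDivisors n = filter prime? (filterᵇ (λ d → ⌊ d ∣? n ⌋) (range1 n))

primeDivisors-unique : ∀ n → Unique (primeDivisors n)
primeDivisors-unique n = Unique.filter⁺ prime? (Unique.filter⁺ _ (range1-unique n))

∈-primeDivisors : ∀ {n p} → 1 ≤ n → p ∈ primeDivisors n ⇔ (Prime p × p ∣ n)
∈-primeDivisors {n} {p} n≥1 = mk⇔ sound complete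
  where
  divides? = λ d → T? ⌊ d ∣? n ⌋
  sound : p ∈ primeDivisors n → Prime p × p ∣ n
  sound p∈ with ∈-filter⁻ prime? {xs = filterᵇ (λ d → ⌊ d ∣? n ⌋) (range1 n)} p∈
  ... | (p∈divisors , p-prime) = p-prime , toWitness (proj₂ (∈-filter⁻ divides? {xs = range1 n} p∈divisors))
  complete : Prime p × p ∣ n → p ∈ primeDivisors n
  complete (p-prime , p∣n) = ∈-filter⁺ prime? (∈-filter⁺ divides?
    (∈-range1⁺ (>-nonZero⁻¹ p {{prime⇒nonZero p-prime}}) (∣⇒≤ {{>-nonZero n≥1}} p∣n)) (fromWitness p∣n)) p-prime

*-∣-self⇒1 : ∀ {g k} → 1 ≤ g → g * k ∣ g → k ≡ 1
*-∣-self⇒1 {g} {k} g≥1 gk∣g =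
  ∣1⇒≡1 (*-cancelˡ-∣ g {{>-nonZero g≥1}} (subst (g * k ∣_) (sym (*-identityʳ g)) gk∣g))

gcd-positive : ∀ {u y} → 1 ≤ y → 1 ≤ gcd u y
gcd-positive {u} {y} y≥1 with gcd u y | gcd[m,n]∣n u y
... | zero  | divides q y≡0 = ⊥-elim (<⇒≢ y≥1 (sym (trans y≡0 (*-zeroʳ q))))
... | suc _ | _ = s≤s z≤n

coprime-∣ : ∀ {a b x y} → Coprime a b → x ∣ a → y ∣ b → Coprime x y
coprime-∣ cop x∣a y∣b (d∣x , d∣y) = cop (∣-trans d∣x x∣a , ∣-trans d∣y y∣b)

coprime-*ˡ : ∀ {g k v} → Coprime g v → Coprime k v → Coprime (g * k) v
coprime-*ˡ {g} {k} {v} g⊥v k⊥v {d} (d∣gk , d∣v) = k⊥v (coprime-divisor d⊥g d∣gk , d∣v)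
  where
  d⊥g : Coprime d g
  d⊥g = gcd≡1⇒coprime (g⊥v (gcd[m,n]∣n d g , ∣-trans (gcd[m,n]∣m d g) d∣v))

unitary-restrict : ∀ {u x y} → UnitaryDivisor u x → y ∣ x → 1 ≤ y → UnitaryDivisor (gcd u y) y
unitary-restrict {u} {x} {y} (v , x≡uv , u⊥v) y∣x y≥1 with gcd[m,n]∣n u y
... | divides w y≡wg = w , y≡gw , g⊥w
  where
  g = gcd u y
  y≡gw : y ≡ g * w
  y≡gw = trans y≡wg (*-comm w g)
  -- any common divisor k of g and w gives a divisor g·k of y coprime to v, hence dividing u
  g⊥w : Coprime g w
  g⊥w {k} (k∣g , k∣w) = *-∣-self⇒1 (gcd-positive {u} y≥1) (gcd-greatest gk∣u gk∣y)
    where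
    gk∣y : g * k ∣ y
    gk∣y = subst (g * k ∣_) (sym y≡gw) (*-monoʳ-∣ g k∣w)
    gk⊥v : Coprime (g * k) v
    gk⊥v = coprime-*ˡ (coprime-∣ u⊥v (gcd[m,n]∣m u y) ∣-refl)
                      (coprime-∣ u⊥v (∣-trans k∣g (gcd[m,n]∣m u y)) ∣-refl)
    gk∣u : g * k ∣ u
    gk∣u = coprime-divisor gk⊥v (subst (g * k ∣_) (trans x≡uv (*-comm u v)) (∣-trans gk∣y y∣x))

unitary-extend : ∀ {u d₁ d₂} → UnitaryDivisor u d₁ → Coprime u d₂ → UnitaryDivisor u (d₁ * d₂)
unitary-extend {u} {d₁} {d₂} (w , refl , u⊥w) u⊥d₂ =
  w * d₂ , *-assoc u w d₂ , Coprime.sym (coprime-*ˡ (Coprime.sym u⊥w) (Coprime.sym u⊥d₂))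

gcd-coprime-factor : ∀ {a b d₁ d₂ u} → Coprime a b → d₁ ∣ a → d₂ ∣ b → u ∣ d₁ * d₂ →
  gcd u d₁ ≡ gcd u a
gcd-coprime-factor {a} {b} {d₁} {d₂} {u} a⊥b d₁∣a d₂∣b u∣d₁d₂ = ∣-antisym
  (gcd-greatest (gcd[m,n]∣m u d₁) (∣-trans (gcd[m,n]∣n u d₁) d₁∣a))
  (gcd-greatest (gcd[m,n]∣m u a) gcd[u,a]∣d₁)
  where
  gcd[u,a]∣d₁ : gcd u a ∣ d₁
  gcd[u,a]∣d₁ = coprime-divisor (coprime-∣ a⊥b (gcd[m,n]∣n u a) d₂∣b)
    (subst (gcd u a ∣_) (*-comm d₁ d₂) (∣-trans (gcd[m,n]∣m u a) u∣d₁d₂))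

unitary-restrict-coprime : ∀ {a b d₁ d₂ u} → Coprime a b → d₁ ∣ a → d₂ ∣ b → 1 ≤ d₁ →
  UnitaryDivisor u (d₁ * d₂) → UnitaryDivisor (gcd u a) d₁
unitary-restrict-coprime {d₁ = d₁} {d₂} {u} a⊥b d₁∣a d₂∣b d₁≥1 ud =
  subst (λ g → UnitaryDivisor g d₁) (gcd-coprime-factor a⊥b d₁∣a d₂∣b (unitary-∣ ud))
    (unitary-restrict ud (m∣m*n d₂) d₁≥1)

-- Cross factorisation: if d·e = a·b > 0 with a ⊥ b, then d = d₁d₂, e = e₁e₂, a = d₁e₁, b = d₂e₂
-- (take d₁ = gcd(d, a)).
record CrossFactorisation (a b d e : ℕ) : Set where
  field
    d₁ e₁ d₂ e₂ : ℕ
    a≡d₁e₁ : a ≡ d₁ * e₁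
    b≡d₂e₂ : b ≡ d₂ * e₂
    d≡d₁d₂ : d ≡ d₁ * d₂
    e≡e₁e₂ : e ≡ e₁ * e₂

crossFactorise : ∀ {a b d e} → 1 ≤ a * b → d * e ≡ a * b → Coprime a b → CrossFactorisation a b d e
crossFactorise {a} {b} {d} {e} ab≥1 de≡ab a⊥b
  with gcd[m,n]∣m d a | gcd[m,n]∣n d a
... | divides d′ d≡d′g | divides a′ a≡a′g = split d′∣b
  where
  g = gcd d a
  g≥1 : 1 ≤ g
  g≥1 = gcd-positive {d} (proj₁ (factors-positive {a} ab≥1))
  d≡gd′ : d ≡ g * d′
  d≡gd′ = trans d≡d′g (*-comm d′ g)
  a≡ga′ : a ≡ g * a′
  a≡ga′ = trans a≡a′g (*-comm a′ g)
  d′≥1 : 1 ≤ d′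
  d′≥1 = proj₂ (factors-positive {g} (subst (1 ≤_) d≡gd′
           (proj₁ (factors-positive {d} (subst (1 ≤_) (sym de≡ab) ab≥1)))))
  d′⊥a′ : Coprime d′ a′
  d′⊥a′ {k} (k∣d′ , k∣a′) = *-∣-self⇒1 g≥1 (gcd-greatest
    (subst (g * k ∣_) (sym d≡gd′) (*-monoʳ-∣ g k∣d′))
    (subst (g * k ∣_) (sym a≡ga′) (*-monoʳ-∣ g k∣a′)))
  reassoc : ∀ x y z → x * y * z ≡ x * (y * z)
  reassoc = solve-∀
  d′e≡a′b : d′ * e ≡ a′ * b
  d′e≡a′b = *-cancelˡ-≡ (d′ * e) (a′ * b) g {{>-nonZero g≥1}} (begin
    g * (d′ * e) ≡⟨ sym (reassoc g d′ e) ⟩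
    g * d′ * e   ≡⟨ cong (_* e) (sym d≡gd′) ⟩
    d * e        ≡⟨ de≡ab ⟩
    a * b        ≡⟨ cong (_* b) a≡ga′ ⟩
    g * a′ * b   ≡⟨ reassoc g a′ b ⟩
    g * (a′ * b) ∎)
    where open ≡-Reasoning
  d′∣b : d′ ∣ b
  d′∣b = coprime-divisor d′⊥a′ (divides e (trans (sym d′e≡a′b) (*-comm d′ e)))
  split : d′ ∣ b → CrossFactorisation a b d e
  split (divides q b≡qd′) = record
    { d₁ = g ; e₁ = a′ ; d₂ = d′ ; e₂ = q
    ; a≡d₁e₁ = a≡ga′ ; b≡d₂e₂ = trans b≡qd′ (*-comm q d′) ; d≡d₁d₂ = d≡gd′
    ; e≡e₁e₂ = *-cancelˡ-≡ e (a′ * q) d′ {{>-nonZero d′≥1}}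
        (trans d′e≡a′b (trans (cong (a′ *_) b≡qd′) (rotate a′ q d′))) }
    where
    rotate : ∀ x y z → x * (y * z) ≡ z * (x * y)
    rotate = solve-∀

unitarilyCoprime-* : ∀ {a b d₁ e₁ d₂ e₂} → 1 ≤ a → 1 ≤ b → Coprime a b →
  a ≡ d₁ * e₁ → b ≡ d₂ * e₂ → UnitarilyCoprime d₁ e₁ → UnitarilyCoprime d₂ e₂ →
  UnitarilyCoprime (d₁ * d₂) (e₁ * e₂)
unitarilyCoprime-* {a} {b} {d₁} {e₁} {d₂} {e₂} a≥1 b≥1 a⊥b a≡ b≡ cop₁ cop₂ u u>1 ud ue
  with 1 <? gcd u a | 1 <? gcd u b
... | yes g₁>1 | _ = cop₁ (gcd u a) g₁>1
        (unitary-restrict-coprime a⊥b (divides e₁ (trans a≡ (*-comm d₁ e₁))) (divides e₂ (trans b≡ (*-comm d₂ e₂))) d₁≥1 ud)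
        (unitary-restrict-coprime a⊥b (divides d₁ a≡) (divides d₂ b≡) e₁≥1 ue)
  where
  d₁≥1 = proj₁ (factors-positive {d₁} (subst (1 ≤_) a≡ a≥1))
  e₁≥1 = proj₂ (factors-positive {d₁} (subst (1 ≤_) a≡ a≥1))
... | no _ | yes g₂>1 = cop₂ (gcd u b) g₂>1
        (unitary-restrict-coprime b⊥a (divides e₂ (trans b≡ (*-comm d₂ e₂))) (divides e₁ (trans a≡ (*-comm d₁ e₁))) d₂≥1
           (subst (UnitaryDivisor u) (*-comm d₁ d₂) ud))
        (unitary-restrict-coprime b⊥a (divides d₂ b≡) (divides d₁ a≡) e₂≥1
           (subst (UnitaryDivisor u) (*-comm e₁ e₂) ue))
  where
  b⊥a = Coprime.sym a⊥b
  d₂≥1 = proj₁ (factors-positive {d₂} (subst (1 ≤_) b≡ b≥1))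
  e₂≥1 = proj₂ (factors-positive {d₂} (subst (1 ≤_) b≡ b≥1))
... | no g₁≯1 | no g₂≯1 = <⇒≱ u>1 (subst (u ≤_) g₂≡1 (∣⇒≤ {{>-nonZero (gcd-positive {u} b≥1)}} u∣g₂))
  -- otherwise u ⊥ a, so u ∣ b, so u ∣ gcd(u, b) = 1
  where
  g₁≡1 : gcd u a ≡ 1
  g₁≡1 = ≤-antisym (≮⇒≥ g₁≯1) (gcd-positive {u} a≥1)
  g₂≡1 : gcd u b ≡ 1
  g₂≡1 = ≤-antisym (≮⇒≥ g₂≯1) (gcd-positive {u} b≥1)
  interchange : ∀ x y z w → x * y * (z * w) ≡ x * z * (y * w)
  interchange = solve-∀
  u∣ab : u ∣ a * b
  u∣ab = ∣-trans (unitary-∣ ud) (divides (e₁ * e₂)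
    (trans (cong₂ _*_ a≡ b≡) (trans (interchange d₁ e₁ d₂ e₂) (*-comm (d₁ * d₂) (e₁ * e₂)))))
  u∣g₂ : u ∣ gcd u b
  u∣g₂ = gcd-greatest ∣-refl (coprime-divisor (gcd≡1⇒coprime g₁≡1) u∣ab)

unitarilyCoprime-*⁻ : ∀ {a b d₁ e₁ d₂ e₂} → Coprime a b → d₁ ∣ a → e₁ ∣ a → d₂ ∣ b → e₂ ∣ b →
  UnitarilyCoprime (d₁ * d₂) (e₁ * e₂) → UnitarilyCoprime d₁ e₁
unitarilyCoprime-*⁻ a⊥b d₁∣a e₁∣a d₂∣b e₂∣b cop u u>1 ud₁ ue₁ = cop u u>1
  (unitary-extend ud₁ (coprime-∣ a⊥b (∣-trans (unitary-∣ ud₁) d₁∣a) d₂∣b))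
  (unitary-extend ue₁ (coprime-∣ a⊥b (∣-trans (unitary-∣ ue₁) e₁∣a) e₂∣b))

biunitary-* : ∀ {a b d₁ d₂} → 1 ≤ a → 1 ≤ b → Coprime a b →
  BiunitaryDivisor d₁ a → BiunitaryDivisor d₂ b → BiunitaryDivisor (d₁ * d₂) (a * b)
biunitary-* {d₁ = d₁} {d₂} a≥1 b≥1 a⊥b (e₁ , a≡ , cop₁) (e₂ , b≡ , cop₂) =
  e₁ * e₂ , trans (cong₂ _*_ a≡ b≡) (interchange d₁ e₁ d₂ e₂) ,
  unitarilyCoprime-* a≥1 b≥1 a⊥b a≡ b≡ cop₁ cop₂
  where
  interchange : ∀ x y z w → x * y * (z * w) ≡ x * z * (y * w)
  interchange = solve-∀

biunitary-split : ∀ {a b d} → 1 ≤ a * b → Coprime a b → BiunitaryDivisor d (a * b) →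
  ∃ λ d₁ → ∃ λ d₂ → d ≡ d₁ * d₂ × BiunitaryDivisor d₁ a × BiunitaryDivisor d₂ b
biunitary-split {d = d} ab≥1 a⊥b (e , ab≡de , cop) =
  d₁ , d₂ , d≡d₁d₂ ,
  (e₁ , a≡d₁e₁ , unitarilyCoprime-*⁻ a⊥b d₁∣a e₁∣a d₂∣b e₂∣b cop′) ,
  (e₂ , b≡d₂e₂ , unitarilyCoprime-*⁻ (Coprime.sym a⊥b) d₂∣b e₂∣b d₁∣a e₁∣a
                   (subst₂ UnitarilyCoprime (*-comm d₁ d₂) (*-comm e₁ e₂) cop′))
  where
  open CrossFactorisation (crossFactorise {d = d} {e} ab≥1 (sym ab≡de) a⊥b)
  cop′ : UnitarilyCoprime (d₁ * d₂) (e₁ * e₂)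
  cop′ = subst₂ UnitarilyCoprime d≡d₁d₂ e≡e₁e₂ cop
  d₁∣a = divides e₁ (trans a≡d₁e₁ (*-comm d₁ e₁))
  e₁∣a = divides d₁ a≡d₁e₁
  d₂∣b = divides e₂ (trans b≡d₂e₂ (*-comm d₂ e₂))
  e₂∣b = divides d₂ b≡d₂e₂

coprime-split-unique : ∀ {a b d₁ d₂ d₁′ d₂′} → Coprime a b → 1 ≤ d₁ →
  d₁ ∣ a → d₂ ∣ b → d₁′ ∣ a → d₂′ ∣ b → d₁ * d₂ ≡ d₁′ * d₂′ → d₁ ≡ d₁′ × d₂ ≡ d₂′
coprime-split-unique {d₁ = d₁} {d₂} {d₁′} {d₂′} a⊥b d₁≥1 d₁∣a d₂∣b d₁′∣a d₂′∣b eq =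
  d₁≡d₁′ , *-cancelˡ-≡ d₂ d₂′ d₁ {{>-nonZero d₁≥1}} (trans eq (cong (_* d₂′) (sym d₁≡d₁′)))
  where
  d₁≡d₁′ : d₁ ≡ d₁′
  d₁≡d₁′ = ∣-antisym
    (coprime-divisor (coprime-∣ a⊥b d₁∣a d₂′∣b) (divides d₂ (trans (*-comm d₂′ d₁′) (trans (sym eq) (*-comm d₁ d₂)))))
    (coprime-divisor (coprime-∣ a⊥b d₁′∣a d₂∣b) (divides d₂′ (trans (*-comm d₂ d₁) (trans eq (*-comm d₁′ d₂′)))))

-- σ** is multiplicative: d₁, d₂ ↦ d₁d₂ is a bijection from pairs of biunitary divisors
-- of a and b onto the biunitary divisors of a·b.
σ**-multiplicative : ∀ {a b} → 1 ≤ a → 1 ≤ b → Coprime a b → σ** (a * b) ≡ σ** a * σ** b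
σ**-multiplicative {a} {b} a≥1 b≥1 a⊥b =
  trans (sameMembers⇒sum≡ (biunitaryDivisors-unique (a * b)) products-unique (mk⇔ split combine))
        (sum-cartesianProduct (biunitaryDivisors a) (biunitaryDivisors b))
  where
  ab≥1 : 1 ≤ a * b
  ab≥1 = *-mono-≤ a≥1 b≥1
  pairs : List (ℕ × ℕ)
  pairs = cartesianProduct (biunitaryDivisors a) (biunitaryDivisors b)
  products : List ℕ
  products = map (uncurry _*_) pairs
  ∈pairs⁻ : ∀ {d₁ d₂} → (d₁ , d₂) ∈ pairs → BiunitaryDivisor d₁ a × BiunitaryDivisor d₂ b
  ∈pairs⁻ p∈ with ∈-cartesianProduct⁻ (biunitaryDivisors a) (biunitaryDivisors b) p∈
  ... | (d₁∈ , d₂∈) = to (∈-biunitaryDivisors a≥1) d₁∈ , to (∈-biunitaryDivisors b≥1) d₂∈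
  product-injective : ∀ {p q} → p ∈ pairs → q ∈ pairs → uncurry _*_ p ≡ uncurry _*_ q → p ≡ q
  product-injective {d₁ , d₂} p∈ q∈ eq with ∈pairs⁻ p∈ | ∈pairs⁻ q∈
  ... | ((e₁ , a≡ , _) , bd₂) | (bd₁′ , bd₂′) =
    let (d₁≡ , d₂≡) = coprime-split-unique a⊥b (proj₁ (factors-positive {d₁} (subst (1 ≤_) a≡ a≥1)))
          (divides e₁ (trans a≡ (*-comm d₁ e₁))) (bi-∣ bd₂) (bi-∣ bd₁′) (bi-∣ bd₂′) eq
    in cong₂ _,_ d₁≡ d₂≡
    where
    bi-∣ : ∀ {d n} → BiunitaryDivisor d n → d ∣ n
    bi-∣ {d} (e , n≡de , _) = divides e (trans n≡de (*-comm d e))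
  products-unique : Unique products
  products-unique = map-unique (uncurry _*_)
    (Unique.cartesianProduct⁺ (biunitaryDivisors-unique a) (biunitaryDivisors-unique b)) product-injective
  split : ∀ {d} → d ∈ biunitaryDivisors (a * b) → d ∈ products
  split d∈ =
    let (d₁ , d₂ , d≡d₁d₂ , bd₁ , bd₂) = biunitary-split {a} {b} ab≥1 a⊥b (to (∈-biunitaryDivisors ab≥1) d∈)
    in subst (_∈ products) (sym d≡d₁d₂) (∈-map⁺ (uncurry _*_) (∈-cartesianProduct⁺
         (from (∈-biunitaryDivisors a≥1) bd₁) (from (∈-biunitaryDivisors b≥1) bd₂)))
  combine : ∀ {d} → d ∈ products → d ∈ biunitaryDivisors (a * b)
  combine d∈ =
    let ((d₁ , d₂) , p∈ , d≡d₁d₂) = ∈-map⁻ (uncurry _*_) d∈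
        (bd₁ , bd₂) = ∈pairs⁻ p∈
    in subst (_∈ biunitaryDivisors (a * b)) (sym d≡d₁d₂)
         (from (∈-biunitaryDivisors ab≥1) (biunitary-* a≥1 b≥1 a⊥b bd₁ bd₂))

odd⇒%2≡1 : ∀ {x} → ¬ 2 ∣ x → x % 2 ≡ 1
odd⇒%2≡1 {x} x-odd with x % 2 | m%n<n x 2 | m%n≡0⇒n∣m x 2
... | 0 | _ | %2≡0⇒even = ⊥-elim (x-odd (%2≡0⇒even refl))
... | 1 | _ | _ = refl
... | suc (suc _) | s≤s (s≤s ()) | _

odd+odd-even : ∀ {x y} → ¬ 2 ∣ x → ¬ 2 ∣ y → 2 ∣ x + y
odd+odd-even {x} {y} x-odd y-odd = m%n≡0⇒n∣m (x + y) 2 (begin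
  (x + y) % 2           ≡⟨ %-distribˡ-+ x y 2 ⟩
  (x % 2 + y % 2) % 2   ≡⟨ cong₂ (λ r s → (r + s) % 2) (odd⇒%2≡1 x-odd) (odd⇒%2≡1 y-odd) ⟩
  0                     ∎)
  where open ≡-Reasoning

codivisor : ℕ → ℕ → ℕ
codivisor q zero    = 0
codivisor q (suc k) = q / suc k

codivisor-biunitary : ∀ {q d} → 1 ≤ q → BiunitaryDivisor d q →
  q ≡ d * codivisor q d × UnitarilyCoprime d (codivisor q d)
codivisor-biunitary {q} {zero} q≥1 (e , q≡0 , _) = ⊥-elim (<⇒≢ q≥1 (sym q≡0))
codivisor-biunitary {q} {suc k} q≥1 (e , q≡de , cop) =
  subst (λ c → q ≡ suc k * c × UnitarilyCoprime (suc k) c) (sym c≡e) (q≡de , cop)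
  where
  c≡e : q / suc k ≡ e
  c≡e = trans (cong (_/ suc k) (trans q≡de (*-comm (suc k) e))) (m*n/n≡m e (suc k))

-- For odd q > 1, σ**(q) is even: d ↦ q / d is a fixed-point-free involution of the
-- biunitary divisors of q (a fixed point d would be a common unitary divisor of d and q / d),
-- and d + q / d is a sum of two odd numbers.
σ**-odd-even : ∀ {q} → 1 < q → ¬ 2 ∣ q → 2 ∣ σ** q
σ**-odd-even {q} q>1 q-odd = involution-sum-even (biunitaryDivisors q) (biunitaryDivisors-unique q)
  (codivisor q) closed involutive fixpoint-free pairs-even
  where
  q≥1 = <⇒≤ q>1
  pairing : ∀ {d} → d ∈ biunitaryDivisors q → q ≡ d * codivisor q d × UnitarilyCoprime d (codivisor q d)
  pairing d∈ = codivisor-biunitary q≥1 (to (∈-biunitaryDivisors q≥1) d∈)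
  closed : ∀ {d} → d ∈ biunitaryDivisors q → codivisor q d ∈ biunitaryDivisors q
  closed {d} d∈ with pairing d∈
  ... | (q≡dc , cop) = from (∈-biunitaryDivisors q≥1)
    (d , trans q≡dc (*-comm d _) , unitarilyCoprime-sym cop)
  involutive : ∀ {d} → d ∈ biunitaryDivisors q → codivisor q (codivisor q d) ≡ d
  involutive {d} d∈ with pairing d∈ | pairing (closed d∈)
  ... | (q≡dc , _) | (q≡cc′ , _) = sym (*-cancelˡ-≡ d _ (codivisor q d) {{>-nonZero c≥1}}
          (trans (*-comm _ d) (trans (sym q≡dc) q≡cc′)))
    where
    c≥1 = proj₂ (factors-positive {d} (subst (1 ≤_) q≡dc q≥1))
  fixpoint-free : ∀ {d} → d ∈ biunitaryDivisors q → codivisor q d ≢ d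
  fixpoint-free {d} d∈ c≡d with pairing d∈
  ... | (q≡dc , cop) = cop d d>1 (unitary-self d) (subst (UnitaryDivisor d) (sym c≡d) (unitary-self d))
    where
    d>1 : 1 < d
    d>1 with m≤n⇒m<n∨m≡n (proj₁ (factors-positive {d} (subst (1 ≤_) q≡dc q≥1)))
    ... | inj₁ 1<d = 1<d
    ... | inj₂ refl = ⊥-elim (<⇒≢ q>1 (sym (trans q≡dc (trans (*-identityˡ _) c≡d))))
  pairs-even : ∀ {d} → d ∈ biunitaryDivisors q → 2 ∣ d + codivisor q d
  pairs-even {d} d∈ with pairing d∈
  ... | (q≡dc , _) = odd+odd-even
    (λ 2∣d → q-odd (∣-trans 2∣d (divides (codivisor q d) (trans q≡dc (*-comm d _)))))
    (λ 2∣c → q-odd (∣-trans 2∣c (divides d q≡dc)))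

prime-coprime : ∀ {p x} → Prime p → ¬ p ∣ x → Coprime p x
prime-coprime p-prime p∤x (d∣p , d∣x) with prime⇒irreducible p-prime d∣p
... | inj₁ d≡1 = d≡1
... | inj₂ refl = ⊥-elim (p∤x d∣x)

prime^-coprime : ∀ {p x} e → Prime p → ¬ p ∣ x → Coprime (p ^ e) x
prime^-coprime {x = x} zero    _ _ = 1-coprimeTo x
prime^-coprime         (suc e) p-prime p∤x = coprime-*ˡ (prime-coprime p-prime p∤x) (prime^-coprime e p-prime p∤x)

∣prime^⇒prime∣ : ∀ {p y} e → Prime p → y ∣ p ^ e → y ≢ 1 → p ∣ y
∣prime^⇒prime∣ {p} {y} e p-prime y∣p^e y≢1 with p ∣? y
... | yes p∣y = p∣y
... | no p∤y = ⊥-elim (y≢1 (prime^-coprime e p-prime p∤y (y∣p^e , ∣-refl)))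

prime∣prime^⇒≡ : ∀ {x p} e → Prime x → Prime p → x ∣ p ^ e → x ≡ p
prime∣prime^⇒≡ zero x-prime _ x∣1 with refl ← ∣1⇒≡1 x∣1 = ⊥-elim (¬prime[1] x-prime)
prime∣prime^⇒≡ {x} {p} (suc e) x-prime p-prime x∣p^e+1 with euclidsLemma p (p ^ e) x-prime x∣p^e+1
... | inj₂ x∣p^e = prime∣prime^⇒≡ e x-prime p-prime x∣p^e
... | inj₁ x∣p with prime⇒irreducible p-prime x∣p
...   | inj₂ x≡p = x≡p
...   | inj₁ refl = ⊥-elim (¬prime[1] x-prime)

-- σ**(2^e) is odd: 1 is a biunitary divisor of 2^e and all the others are even.
biunitary-1 : ∀ {n} → 1 ≤ n → BiunitaryDivisor 1 n
biunitary-1 {n} n≥1 = n , sym (*-identityˡ n) ,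
  λ u u>1 u∥1 _ → <⇒≢ u>1 (sym (∣1⇒≡1 (unitary-∣ u∥1)))

σ**-2^e-odd : ∀ e → ¬ 2 ∣ σ** (2 ^ e)
σ**-2^e-odd e 2∣σ = ⊥-elim (<⇒≱ (s≤s (s≤s z≤n)) (∣⇒≤ 2∣1))
  where
  n = 2 ^ e
  n≥1 = m^n>0 2 e
  L = biunitaryDivisors n
  one? = λ x → x ≟ 1
  others = filter (λ x → ¬? (one? x)) L
  sum-ones : sum (filter one? L) ≡ 1
  sum-ones = sameMembers⇒sum≡ (Unique.filter⁺ one? (biunitaryDivisors-unique n)) ([] ∷ [])
    (mk⇔ (λ x∈ → here (proj₂ (∈-filter⁻ one? {xs = L} x∈)))
         (λ { (here refl) → ∈-filter⁺ one? (from (∈-biunitaryDivisors n≥1) (biunitary-1 n≥1)) refl }))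
  others-even : 2 ∣ sum others
  others-even = sum-even others λ {x} x∈ →
    let (x∈L , x≢1) = ∈-filter⁻ (λ x → ¬? (one? x)) {xs = L} x∈
        (f , n≡xf , _) = to (∈-biunitaryDivisors n≥1) x∈L
    in ∣prime^⇒prime∣ e prime[2] (divides f (trans n≡xf (*-comm x f))) x≢1
  2∣1 : 2 ∣ 1
  2∣1 = ∣m+n∣m⇒∣n (subst (2 ∣_) (trans (sum-partition one? L) (trans (cong (_+ sum others) sum-ones) (+-comm 1 _))) 2∣σ)
          others-even

record PrimePowerSplit (p n : ℕ) : Set where
  field
    exponent cofactor : ℕ
    n≡p^e*r : n ≡ p ^ exponent * cofactor
    p∤cofactor : ¬ p ∣ cofactor
    cofactor≥1 : 1 ≤ cofactor

splitPower : ∀ {p} → 1 < p → ∀ n → 1 ≤ n → PrimePowerSplit p n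
splitPower {p} p>1 = <-rec (λ n → 1 ≤ n → PrimePowerSplit p n) step
  where
  step : ∀ n → (∀ {m} → m < n → 1 ≤ m → PrimePowerSplit p m) → 1 ≤ n → PrimePowerSplit p n
  step n rec n≥1 with p ∣? n
  ... | no p∤n = record { exponent = 0 ; cofactor = n ; n≡p^e*r = sym (+-identityʳ n) ; p∤cofactor = p∤n ; cofactor≥1 = n≥1 }
  ... | yes (divides q n≡qp) = record
    { exponent = suc exponent ; cofactor = cofactor ; n≡p^e*r = n≡ ; p∤cofactor = p∤cofactor ; cofactor≥1 = cofactor≥1 }
    where
    q≥1 = proj₁ (factors-positive {q} (subst (1 ≤_) n≡qp n≥1))
    q<n : q < n
    q<n = subst (q <_) (sym n≡qp) (subst (_< q * p) (*-identityʳ q) (*-monoʳ-< q {{>-nonZero q≥1}} p>1))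
    open PrimePowerSplit (rec q<n q≥1)
    n≡ : n ≡ p ^ suc exponent * cofactor
    n≡ = trans n≡qp (trans (cong (_* p) n≡p^e*r) (rotate p (p ^ exponent) cofactor))
      where
      rotate : ∀ a b c → b * c * a ≡ a * b * c
      rotate = solve-∀

split-exponent-positive : ∀ {p e r} → p ∣ p ^ e * r → ¬ p ∣ r → 1 ≤ e
split-exponent-positive {e = zero} {r} p∣r p∤r = ⊥-elim (p∤r (subst (_ ∣_) (*-identityˡ r) p∣r))
split-exponent-positive {e = suc _} _ _ = s≤s z≤n

σ**-prime-power-* : ∀ {p r} e → Prime p → 1 ≤ r → ¬ p ∣ r → σ** (p ^ e * r) ≡ σ** (p ^ e) * σ** r
σ**-prime-power-* {p} e p-prime r≥1 p∤r =
  σ**-multiplicative (m^n>0 p {{prime⇒nonZero p-prime}} e) r≥1 (prime^-coprime e p-prime p∤r)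

ω-prime-power-* : ∀ {p r} e → 1 ≤ e → Prime p → 1 ≤ r → ¬ p ∣ r → ω (p ^ e * r) ≡ suc (ω r)
ω-prime-power-* {p} {r} (suc e) _ p-prime r≥1 p∤r = sameMembers⇒length≡
  (primeDivisors-unique n) (All.tabulate p≢ ∷ primeDivisors-unique r) (mk⇔ sound complete)
  where
  n = p ^ suc e * r
  n≥1 : 1 ≤ n
  n≥1 = *-mono-≤ (m^n>0 p {{prime⇒nonZero p-prime}} (suc e)) r≥1
  p≢ : ∀ {x} → x ∈ primeDivisors r → p ≢ x
  p≢ x∈ refl = p∤r (proj₂ (to (∈-primeDivisors r≥1) x∈))
  sound : ∀ {x} → x ∈ primeDivisors n → x ∈ p ∷ primeDivisors r
  sound x∈ with to (∈-primeDivisors n≥1) x∈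
  ... | (x-prime , x∣n) with euclidsLemma (p ^ suc e) r x-prime x∣n
  ... | inj₁ x∣p^e = here (prime∣prime^⇒≡ (suc e) x-prime p-prime x∣p^e)
  ... | inj₂ x∣r = there (from (∈-primeDivisors r≥1) (x-prime , x∣r))
  complete : ∀ {x} → x ∈ p ∷ primeDivisors r → x ∈ primeDivisors n
  complete (here refl) = from (∈-primeDivisors n≥1) (p-prime , ∣-trans (m∣m*n (p ^ e)) (m∣m*n r))
  complete (there x∈) with to (∈-primeDivisors r≥1) x∈
  ... | (x-prime , x∣r) = from (∈-primeDivisors n≥1) (x-prime , ∣-trans x∣r (n∣m*n (p ^ suc e)))

1<^ : ∀ {p} e → 1 < p → 1 ≤ e → 1 < p ^ e
1<^ {p} (suc e) p>1 _ = ≤-trans p>1 (m≤m*n p (p ^ e) {{m^n≢0 p e {{>-nonZero (<⇒≤ p>1)}}}})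

prime-divisor : ∀ m → 1 < m → ∃ λ p → Prime p × p ∣ m
prime-divisor m m>1 = head (PrimeFactorisation.factors F) (PrimeFactorisation.isFactorisation F)
                           (PrimeFactorisation.factorsPrime F)
  where
  F = factorise m {{>-nonZero (<⇒≤ m>1)}}
  head : ∀ ps → m ≡ product ps → All Prime ps → ∃ λ p → Prime p × p ∣ m
  head [] m≡1 _ = ⊥-elim (<⇒≢ m>1 (sym m≡1))
  head (p ∷ ps) m≡ (p-prime ∷ _) = p , p-prime , divides (product ps) (trans m≡ (*-comm p (product ps)))

-- The odd case: 2^ω(m) ∣ σ**(m) for odd m ≥ 1, by strong induction splitting off a
-- prime power q = p^e (e ≥ 1), whose σ** is even since q > 1 is odd.
2^ω∣σ**-odd : ∀ m → 1 ≤ m → ¬ 2 ∣ m → 2 ^ ω m ∣ σ** m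
2^ω∣σ**-odd = <-rec (λ m → 1 ≤ m → ¬ 2 ∣ m → 2 ^ ω m ∣ σ** m) step
  where
  step : ∀ m → (∀ {k} → k < m → 1 ≤ k → ¬ 2 ∣ k → 2 ^ ω k ∣ σ** k) → 1 ≤ m → ¬ 2 ∣ m → 2 ^ ω m ∣ σ** m
  step m rec m≥1 m-odd with m ≟ 1
  ... | yes refl = 1∣ _
  ... | no m≢1 with prime-divisor m (≤∧≢⇒< m≥1 (≢-sym m≢1))
  ... | (p , p-prime , p∣m) = subst (λ k → 2 ^ ω k ∣ σ** k) (sym m≡qr)
          (subst₂ (λ w s → 2 ^ w ∣ s) (sym (ω-prime-power-* e e≥1 p-prime cofactor≥1 p∤cofactor))
                                       (sym (σ**-prime-power-* e p-prime cofactor≥1 p∤cofactor))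
            (*-pres-∣ (σ**-odd-even q>1 (odd-factor (divides cofactor (trans m≡qr (*-comm q cofactor)))))
                      (rec r<m cofactor≥1 (odd-factor (divides q m≡qr)))))
    where
    open PrimePowerSplit (splitPower (nonTrivial⇒n>1 p {{prime⇒nonTrivial p-prime}}) m m≥1)
      renaming (exponent to e; n≡p^e*r to m≡qr)
    q = p ^ e
    e≥1 = split-exponent-positive (subst (p ∣_) m≡qr p∣m) p∤cofactor
    odd-factor : ∀ {x} → x ∣ m → ¬ 2 ∣ x
    odd-factor x∣m 2∣x = m-odd (∣-trans 2∣x x∣m)
    q>1 : 1 < q
    q>1 = 1<^ e (nonTrivial⇒n>1 p {{prime⇒nonTrivial p-prime}}) e≥1
    r<m : cofactor < m
    r<m = subst (cofactor <_) (sym m≡qr)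
            (subst (_< q * cofactor) (*-identityˡ cofactor) (*-monoˡ-< cofactor {{>-nonZero cofactor≥1}} q>1))

-- Write n = 2^k · r with r odd; then σ**(n) = σ**(2^k) σ**(r) where σ**(2^k)
-- is odd and 2^ω(r) ∣ σ**(r). So σ**(n) is odd iff σ**(r) is, i.e. iff r = 1; and for even n
-- (k ≥ 1) we have ω(n) - 1 = ω(r).
mainTheorem2 : (n : ℕ) → 1 ≤ n →
    ((¬ (2 ∣ σ** n)) ⇔ (∃ λ k → n ≡ 2 ^ k))
    × ((¬ (2 ∣ n)) → 2 ^ ω n ∣ σ** n)
    × (2 ∣ n → 2 ^ (ω n ∸ 1) ∣ σ** n)
mainTheorem2 n n≥1 with splitPower {2} (s≤s (s≤s z≤n)) n n≥1
... | record { exponent = k ; cofactor = r ; n≡p^e*r = refl ; p∤cofactor = r-odd ; cofactor≥1 = r≥1 } =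
  mk⇔ odd⇒power power⇒odd , 2^ω∣σ**-odd (2 ^ k * r) n≥1 , even-case
  where
  σ**n≡ : σ** (2 ^ k * r) ≡ σ** (2 ^ k) * σ** r
  σ**n≡ = σ**-prime-power-* k prime[2] r≥1 r-odd
  odd⇒power : ¬ 2 ∣ σ** (2 ^ k * r) → ∃ λ j → 2 ^ k * r ≡ 2 ^ j
  odd⇒power σ-odd with r ≟ 1
  ... | yes refl = k , *-identityʳ (2 ^ k)
  ... | no r≢1 = ⊥-elim (σ-odd (subst (2 ∣_) (sym σ**n≡)
          (∣-trans (σ**-odd-even (≤∧≢⇒< r≥1 (≢-sym r≢1)) r-odd) (n∣m*n (σ** (2 ^ k))))))
  power⇒odd : (∃ λ j → 2 ^ k * r ≡ 2 ^ j) → ¬ 2 ∣ σ** (2 ^ k * r)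
  power⇒odd (j , n≡2^j) = subst (λ m → ¬ 2 ∣ σ** m) (sym n≡2^j) (σ**-2^e-odd j)
  even-case : 2 ∣ 2 ^ k * r → 2 ^ (ω (2 ^ k * r) ∸ 1) ∣ σ** (2 ^ k * r)
  even-case 2∣n = subst₂ (λ w s → 2 ^ (w ∸ 1) ∣ s)
    (sym (ω-prime-power-* k (split-exponent-positive 2∣n r-odd) prime[2] r≥1 r-odd)) (sym σ**n≡)
    (∣-trans (2^ω∣σ**-odd r r≥1 r-odd) (n∣m*n (σ** (2 ^ k))))
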